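{- In $ALFAo$, the inverse of $R_8$ holds: for all graphs $A,B,C$, if $A\vdash_{ALFAo}[B[C]]$ then $AB\vdash_{ALFAo} C$.
   Context: Graphs of $ALFAo$: the empty graph $\emptyset$ and propositional letters are graphs; if $G,H$ are graphs, so are their juxtaposition $GH$ and the cut $[G]$ ($G$ inside a solid closed curve). Juxtaposition is associative and commutative with unit $\emptyset$. Rules are schemata with $A,B,C$ arbitrary (possibly empty) graphs, applied to the whole graph on the sheet. First-degree rules: $R_2: AB\vdash A$; $R_3: [A]\vdash[AB]$; $R_4: [BC[A]]\vdash[BC[AB]]$; $R_5: A[AB]\vdash A[B]$; $R_6: A[[B]]\vdash AB$; $R_7: [AB]\vdash[A[[B]]]$. Second-degree rules: $R_8$: if $AB\vdash C$ then $A\vdash[B[C]]$; $R_0$: if $A\vdash B$ and $A\vdash C$ then $A\vdash BC$. $\vdash_{ALFAo}$ is the least transitive relation on graphs containing all instances of the first-degree rules and closed under the second-degree rules. -}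

module Defs where

open import Data.Nat using (ℕ)

-- Graphs of ALFAo (syntax trees; identified up to _≈_ below).
infixl 6 _·_
data Graph : Set where
  ∅      : Graph
  letter : ℕ → Graph
  _·_    : Graph → Graph → Graph
  cut    : Graph → Graph         -- cut [G]

infix 4 _≈_
data _≈_ : Graph → Graph → Set where
  ≈-refl  : ∀ {G} → G ≈ G
  ≈-sym   : ∀ {G H} → G ≈ H → H ≈ G
  ≈-trans : ∀ {G H K} → G ≈ H → H ≈ K → G ≈ K
  ·-assoc : ∀ {G H K} → (G · H) · K ≈ G · (H · K)
  ·-comm  : ∀ {G H} → G · H ≈ H · G
  ·-unitˡ : ∀ {G} → ∅ · G ≈ G
  ·-cong  : ∀ {G G' H H'} → G ≈ G' → H ≈ H' → G · H ≈ G' · H'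
  cut-cong : ∀ {G G'} → G ≈ G' → cut G ≈ cut G'

-- Derivability ⊢_ALFAo: least transitive relation containing the
-- first-degree rules, closed under the second-degree rules, on graphs
-- taken up to _≈_.
infix 3 _⊢_
data _⊢_ : Graph → Graph → Set where
  R2 : ∀ A B → A · B ⊢ A
  R3 : ∀ A B → cut A ⊢ cut (A · B)
  R4 : ∀ A B C → cut (B · C · cut A) ⊢ cut (B · C · cut (A · B))
  R5 : ∀ A B → A · cut (A · B) ⊢ A · cut B
  R6 : ∀ A B → A · cut (cut B) ⊢ A · B
  R7 : ∀ A B → cut (A · B) ⊢ cut (A · cut (cut B))
  R8 : ∀ {A B C} → A · B ⊢ C → A ⊢ cut (B · cut C)
  R0 : ∀ {A B C} → A ⊢ B → A ⊢ C → A ⊢ B · C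
  ⊢-trans : ∀ {A B C} → A ⊢ B → B ⊢ C → A ⊢ C
  ⊢-resp  : ∀ {A A' B B'} → A ≈ A' → B ≈ B' → A ⊢ B → A' ⊢ B'

module Submission where

open import Defs

projʳ : ∀ A B → A · B ⊢ B
projʳ A B = ⊢-resp ·-comm ≈-refl (R2 B A)

weakenʳ : ∀ {A C} B → A ⊢ C → A · B ⊢ C
weakenʳ {A} B A⊢C = ⊢-trans (R2 A B) A⊢C

modus-ponens : ∀ B C → B · cut (B · cut C) ⊢ C
modus-ponens B C = ⊢-trans (R5 B (cut C)) (⊢-trans (R6 B C) (projʳ B C))

mainTheorem4 : ∀ (A B C : Graph) → A ⊢ cut (B · cut C) → A · B ⊢ C
mainTheorem4 A B C A⊢B⇒C =
  ⊢-trans (R0 (projʳ A B) (weakenʳ B A⊢B⇒C)) (modus-ponens B C)
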